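{- Let $C'$ be a constraint of fixed arity $k$ and let $p\ge1$, $j\ge1$ be integers. Any constraint $C$ on sequences of variables defined by $C(\vec{X})\leftrightarrow\mathrm{Slide}^p_j(C',\vec{X})$ is contractible.
   Context: For a sequence $\vec{X}=[X_1,\ldots,X_n]$, $\mathrm{Slide}^p_j(C',\vec{X})$ holds iff $C'(X_{ij+p},\ldots,X_{ij+p+k-1})$ holds for $i=0,1,\ldots,\lfloor\frac{n-p-k+1}{j}\rfloor$, where $k$ is the arity of $C'$. A constraint $C$ on sequences of variables is contractible if for all $n\ge0$, $C([X_1,\ldots,X_n,Y])\rightarrow C([X_1,\ldots,X_n])$. -}

module Defs where

open import Data.Nat using (ℕ; zero; suc; _+_; _*_; _∸_; _≤_; _<_; NonZero)
open import Data.Nat.DivMod using (_/_)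
open import Data.Nat.Properties using (+-monoʳ-<; <-≤-trans)
open import Data.Fin using (Fin; fromℕ<; toℕ)
open import Data.Fin.Properties using (toℕ<n)
open import Data.Vec using (Vec; lookup; tabulate; _∷ʳ_)

-- Sequences of variables X = [X₁,…,Xₙ] over a domain D are vectors Vec D n.

-- The window X_{s+1}, …, X_{s+k} (1-based; 0-based positions s, …, s+k-1),
-- given a proof that it lies inside X.
window : {D : Set} {n : ℕ} (k : ℕ) (X : Vec D n) (s : ℕ) → s + k ≤ n → Vec D k
window k X s h = tabulate (λ l → lookup X (fromℕ< (<-≤-trans (+-monoʳ-< s (toℕ<n l)) h)))

-- Slide^p_j(C', X): C'(X_{ij+p}, …, X_{ij+p+k-1}) holds for i = 0, 1, …, ⌊(n-p-k+1)/j⌋.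
-- When n-p-k+1 < 0 (i.e. n+1 < p+k) the range of i is empty.
-- The 1-based start index ij+p is the 0-based position ij+p-1.  For i in the
-- range the window lies inside X; the fitting proof is taken as an (always
-- satisfiable, proof-irrelevant) extra argument.
Slide : {D : Set} {k : ℕ} (p j : ℕ) .{{_ : NonZero j}} → (Vec D k → Set) →
        {n : ℕ} → Vec D n → Set
Slide {k = k} p j C' {n} X =
  p + k ≤ suc n →
  (i : ℕ) → i ≤ (suc n ∸ (p + k)) / j →
  (h : (i * j + p ∸ 1) + k ≤ n) → C' (window k X (i * j + p ∸ 1) h)

Contractible : {D : Set} → ({n : ℕ} → Vec D n → Set) → Set
Contractible {D} C = (n : ℕ) (X : Vec D n) (Y : D) → C (X ∷ʳ Y) → C X

-- Every window of X is also a window of X ∷ʳ Y, and the range of window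
-- indices of X ∷ʳ Y contains that of X; so each constraint Slide imposes on X
-- is already imposed on X ∷ʳ Y.

module Submission where

open import Defs
open import Data.Nat using (ℕ; zero; suc; _+_; _∸_; _≤_; _<_; NonZero; s≤s)
open import Data.Nat.Properties using (<-≤-trans; +-monoʳ-<; n≤1+n; ≤-trans; ∸-monoˡ-≤; m≤n⇒m≤1+n)
open import Data.Nat.DivMod using (_/_; /-monoˡ-≤)
open import Data.Vec using (Vec; _∷_; lookup; _∷ʳ_)
open import Data.Vec.Properties using (tabulate-cong)
open import Data.Fin using (fromℕ<; toℕ)
open import Data.Fin.Properties using (toℕ<n)
open import Function using (_∘′_)
open import Function.Bundles using (_⇔_; Equivalence)
open import Relation.Binary.PropositionalEquality using (_≡_; refl; subst)

lookup-fromℕ<-∷ʳ : {D : Set} {n : ℕ} (X : Vec D n) (Y : D) (m : ℕ)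
                   (m<1+n : m < suc n) (m<n : m < n) →
                   lookup (X ∷ʳ Y) (fromℕ< m<1+n) ≡ lookup X (fromℕ< m<n)
lookup-fromℕ<-∷ʳ (x ∷ X) Y zero    _             _           = refl
lookup-fromℕ<-∷ʳ (x ∷ X) Y (suc m) (s≤s m<1+n) (s≤s m<n) = lookup-fromℕ<-∷ʳ X Y m m<1+n m<n

window-∷ʳ : {D : Set} {n : ℕ} (k : ℕ) (X : Vec D n) (Y : D) (s : ℕ)
            (fits′ : s + k ≤ suc n) (fits : s + k ≤ n) →
            window k (X ∷ʳ Y) s fits′ ≡ window k X s fits
window-∷ʳ k X Y s fits′ fits = tabulate-cong λ l →
  lookup-fromℕ<-∷ʳ X Y (s + toℕ l)
    (<-≤-trans (+-monoʳ-< s (toℕ<n l)) fits′)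
    (<-≤-trans (+-monoʳ-< s (toℕ<n l)) fits)

Slide-bound-mono : ∀ n q j .{{_ : NonZero j}} → (n ∸ q) / j ≤ (suc n ∸ q) / j
Slide-bound-mono n q j = /-monoˡ-≤ j (∸-monoˡ-≤ q (n≤1+n n))

Slide-∷ʳ⁻ : {D : Set} {k : ℕ} (p j : ℕ) .{{_ : NonZero j}} (C' : Vec D k → Set)
            {n : ℕ} (X : Vec D n) (Y : D) →
            Slide p j C' (X ∷ʳ Y) → Slide p j C' X
Slide-∷ʳ⁻ {k = k} p j C' {n} X Y slide p+k≤1+n i i≤bound fits =
  subst C' (window-∷ʳ k X Y _ fits′ fits)
    (slide (m≤n⇒m≤1+n p+k≤1+n) i (≤-trans i≤bound (Slide-bound-mono (suc n) (p + k) j)) fits′)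
  where fits′ = m≤n⇒m≤1+n fits

proposition3 : {D : Set} (k : ℕ) (C' : Vec D k → Set) (p j : ℕ) → 1 ≤ p → .{{_ : NonZero j}} →
    (C : {n : ℕ} → Vec D n → Set) →
    ({n : ℕ} (X : Vec D n) → C X ⇔ Slide p j C' X) →
    Contractible C
proposition3 k C' p j _ C C⇔Slide n X Y =
  Equivalence.from (C⇔Slide X) ∘′ Slide-∷ʳ⁻ p j C' X Y ∘′ Equivalence.to (C⇔Slide (X ∷ʳ Y))
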